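{- For the elementary cellular automaton $F_{172}$ and every nonempty finite word $u\in\{0,1\}^*$, $D(\textsc{SInv}_{F_{172},u,n})\in O(1)$ as $n\to\infty$.
   Context: The ECA with Wolfram number $N$ is $F_N:\{0,1\}^{\mathbb{Z}}\to\{0,1\}^{\mathbb{Z}}$, $(F_N(x))_i=f_N(x_{i-1},x_i,x_{i+1})$, where $f_N(a,b,c)$ is the bit of index $4a+2b+c$ of $N$ in binary. For a nonempty word $u$, $p_u\in\{0,1\}^{\mathbb{Z}}$ is $(p_u)_i=u_{i\bmod |u|}$; for a finite word $x$, $p_u[x]$ equals $x$ on positions $\{0,\dots,|x|-1\}$ and $p_u$ elsewhere. $\textsc{SInv}_{F,u,n}:\{0,1\}^n\to\{0,1\}$ maps $x$ to $1$ iff there is an integer $w$ such that for every $t\ge 0$ the set of positions where $F^t(p_u)$ and $F^t(p_u[x])$ differ is contained in an interval of length $w$. For finite sets $X,Y,Z$ and $g:X\times Y\to Z$, $D(g)$ is the minimal depth of a deterministic two-party communication protocol tree computing $g$ (Alice knows $x$, Bob knows $y$; internal nodes are labelled by a function of $x$ alone or of $y$ alone to $\{\mathrm{l},\mathrm{r}\}$, leaves by outputs). For $g:\{0,1\}^m\to Z$, $D(g)=\max_{0\le i\le m} D(g_i)$ with $g_i(x,y)=g(xy)$ for $x\in\{0,1\}^i$, $y\in\{0,1\}^{m-i}$. -}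

module Defs where

open import Data.Bool using (Bool; true; false; if_then_else_)
open import Data.Nat as ℕ using (ℕ; zero; suc; _⊔_)
open import Data.Integer as ℤ using (ℤ; +_; _%ℕ_)
open import Data.Integer.DivMod using (n%ℕd<d)
open import Data.Fin using (Fin; fromℕ<)
open import Data.Vec using (Vec; lookup; _++_)
open import Data.Product using (Σ; ∃; ∃-syntax; _×_)
open import Relation.Nullary using (¬_; yes; no)
open import Relation.Binary.PropositionalEquality using (_≡_)
open import Function using (_∘_)

Config : Set
Config = ℤ → Bool

bit : ℕ → ℕ → Bool
bit N zero    = N ℕ.% 2 ℕ.≡ᵇ 1
bit N (suc k) = bit (N ℕ./ 2) k

toℕ : Bool → ℕ
toℕ true  = 1
toℕ false = 0

-- Local rule of the ECA with Wolfram number N: bit of index 4a+2b+c of N.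
localRule : ℕ → Bool → Bool → Bool → Bool
localRule N a b c = bit N (4 ℕ.* toℕ a ℕ.+ 2 ℕ.* toℕ b ℕ.+ toℕ c)

ECA : ℕ → Config → Config
ECA N x i = localRule N (x (i ℤ.- ℤ.1ℤ)) (x i) (x (i ℤ.+ ℤ.1ℤ))

iter : (Config → Config) → ℕ → Config → Config
iter F zero    x = x
iter F (suc t) x = F (iter F t x)

per : ∀ {m} → Vec Bool (suc m) → Config
per {m} u i = lookup u (fromℕ< (n%ℕd<d i (suc m)))

patch : ∀ {m n} → Vec Bool (suc m) → Vec Bool n → Config
patch {n = n} u x (+ k) with k ℕ.<? n
... | yes k<n = lookup x (fromℕ< k<n)
... | no  _   = per u (+ k)
patch u x i@(ℤ.-[1+ _ ]) = per u i

SInv : (Config → Config) → ∀ {m n} → Vec Bool (suc m) → Vec Bool n → Set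
SInv F u x =
  ∃[ w ] ∀ (t : ℕ) → ∃[ a ] ∀ (i : ℤ) →
    ¬ (iter F t (per u) i ≡ iter F t (patch u x) i) →
    (a ℤ.≤ i) × (i ℤ.< a ℤ.+ + w)

data Protocol (X Y : Set) : Set where
  leaf  : Bool → Protocol X Y
  alice : (X → Bool) → Protocol X Y → Protocol X Y → Protocol X Y
  bob   : (Y → Bool) → Protocol X Y → Protocol X Y → Protocol X Y

run : ∀ {X Y} → Protocol X Y → X → Y → Bool
run (leaf b)      x y = b
run (alice f l r) x y = if f x then run r x y else run l x y
run (bob g l r)   x y = if g y then run r x y else run l x y

depth : ∀ {X Y} → Protocol X Y → ℕ
depth (leaf _)      = 0
depth (alice _ l r) = suc (depth l ⊔ depth r)
depth (bob _ l r)   = suc (depth l ⊔ depth r)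

-- P computes the Boolean function whose value-1 set is the predicate G.
Computes : ∀ {X Y} → Protocol X Y → (X → Y → Set) → Set
Computes P G = ∀ x y → (run P x y ≡ true → G x y) × (G x y → run P x y ≡ true)

DSInv≤ : (Config → Config) → ∀ {m} → Vec Bool (suc m) → ℕ → ℕ → Set
DSInv≤ F u n C = ∀ i j → i ℕ.+ j ≡ n →
  Σ (Protocol (Vec Bool i) (Vec Bool j)) λ P →
    (depth P ℕ.≤ C) × Computes P (λ x y → SInv F u (x ++ y))

-- Rule 172 is f(a, b, c) = if a then c else b.  Two adjacent 0s (a wall) persist forever and no
-- information crosses them.  If p_u has a wall, it has one in every period, so walls on both sides
-- of the patch confine the differences for all time and SInv is constantly 1.  Otherwise p_u is
-- wall-free, and SInv(x) holds iff p_u[x] is wall-free too: one step of F turns a wall-free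
-- configuration into one without walls and without gaps 0?0, on which F is the left shift, so the
-- differences travel as a rigid block; but left of the leftmost wall of p_u[x] the run of 0s grows
-- by a cell every two steps, while the wall-free iterates of p_u have a 1 in every pair of cells,
-- so the differences spread without bound.  A wall of p_u[x] can only sit on the cells -1, …, |x|:
-- Alice reports whether her part contains one and otherwise sends her last cell, and Bob decides
-- the rest, a protocol of depth 3 for every n.

module Submission where

open import Data.Bool using (Bool; true; false; if_then_else_) renaming (_≟_ to _≟ᵇ_)
open import Data.Empty using (⊥; ⊥-elim)
open import Data.Fin as Fin using (fromℕ<)
import Data.Fin.Properties as Finₚ
open import Data.Integer as ℤ using (ℤ; +_; -[1+_]; _+_; _-_; -_; _*_; 0ℤ; 1ℤ; -1ℤ; _%ℕ_; _/ℕ_)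
open import Data.Integer.DivMod using (n%ℕd<d; a≡a%ℕn+[a/ℕn]*n)
import Data.Integer.Properties as ℤₚ
open import Data.Integer.Tactic.RingSolver using (solve-∀)
open import Data.Nat as ℕ using (ℕ; zero; suc; z≤n; s≤s; _∸_; _≥_)
open import Data.Nat.DivMod using (n%n≡0; [m+n]%n≡m%n; m<n⇒m%n≡m)
import Data.Nat.Properties as ℕₚ
open import Relation.Binary.Definitions using (tri<; tri≈; tri>)
open import Data.Product using (∃-syntax; _×_; _,_; proj₁; proj₂)
open import Data.Sum using (_⊎_; inj₁; inj₂; [_,_]′)
open import Data.Vec using (Vec; lookup; _++_; replicate)
import Data.Vec.Properties as VecP
open import Relation.Nullary using (¬_; Dec; yes; no; does)
open import Relation.Nullary.Decidable using (_×-dec_; _⊎-dec_; map′)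
open import Relation.Binary.PropositionalEquality
open import Function.Base using (_∘_)
open import Function.Bundles using (_⇔_; mk⇔; Equivalence)
open import Function.Properties.Equivalence using () renaming (trans to ⇔-trans; sym to ⇔-sym)
open import Function.Related.TypeIsomorphisms using (¬-cong-⇔)
open import Data.Nat.Induction using (<-rec)

open import Defs

rule172 : Bool → Bool → Bool → Bool
rule172 a b c = if a then c else b

localRule-172 : ∀ a b c → localRule 172 a b c ≡ rule172 a b c
localRule-172 false false false = refl
localRule-172 false false true  = refl
localRule-172 false true  false = refl
localRule-172 false true  true  = refl
localRule-172 true  false false = refl
localRule-172 true  false true  = refl
localRule-172 true  true  false = refl
localRule-172 true  true  true  = refl

rule172-ff : ∀ a → rule172 a false false ≡ false
rule172-ff false = refl
rule172-ff true  = refl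

rule172-tt : ∀ a → rule172 a true true ≡ true
rule172-tt false = refl
rule172-tt true  = refl

rule172-wall-origin : ∀ a b c d → rule172 a b c ≡ false → rule172 b c d ≡ false →
  (a ≡ false × b ≡ false) ⊎ (b ≡ false × c ≡ false) ⊎ (c ≡ false × d ≡ false)
rule172-wall-origin false false c     d     _ _ = inj₁ (refl , refl)
rule172-wall-origin true  false false true  _ _ = inj₂ (inj₁ (refl , refl))
rule172-wall-origin true  b     false false _ _ = inj₂ (inj₂ (refl , refl))
rule172-wall-origin false true  c     d     () _
rule172-wall-origin true  true  false true  _ ()
rule172-wall-origin true  b     true  d     () _

rule172-gap-origin : ∀ a b c d e → rule172 a b c ≡ false → rule172 c d e ≡ false →
  (a ≡ false × b ≡ false) ⊎ (c ≡ false × d ≡ false)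
rule172-gap-origin false false c     d     e _ _ = inj₁ (refl , refl)
rule172-gap-origin true  b     false false e _ _ = inj₂ (refl , refl)
rule172-gap-origin false true  c     d     e () _
rule172-gap-origin true  b     false true  e _ ()
rule172-gap-origin true  b     true  d     e () _

rule172-copies-right : ∀ a b c → ¬ (a ≡ false × b ≡ false) → ¬ (a ≡ false × c ≡ false) →
  rule172 a b c ≡ c
rule172-copies-right true  b     c     _ _ = refl
rule172-copies-right false true  true  _ _ = refl
rule172-copies-right false false c     h _ = ⊥-elim (h (refl , refl))
rule172-copies-right false true  false _ h = ⊥-elim (h (refl , refl))

i-1+1≡i : ∀ i → i - 1ℤ + 1ℤ ≡ i
i-1+1≡i = solve-∀

i+1-1≡i : ∀ i → i + 1ℤ - 1ℤ ≡ i
i+1-1≡i = solve-∀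

F : Config → Config
F = ECA 172

F-at : ∀ c z → F c z ≡ rule172 (c (z - 1ℤ)) (c z) (c (z + 1ℤ))
F-at c z = localRule-172 (c (z - 1ℤ)) (c z) (c (z + 1ℤ))

F-at-values : ∀ c z {a b e} → c (z - 1ℤ) ≡ a → c z ≡ b → c (z + 1ℤ) ≡ e → F c z ≡ rule172 a b e
F-at-values c z refl refl refl = F-at c z

F-at-pred : ∀ c z → F c (z - 1ℤ) ≡ rule172 (c (z - 1ℤ - 1ℤ)) (c (z - 1ℤ)) (c z)
F-at-pred c z = F-at-values c (z - 1ℤ) refl refl (cong c (i-1+1≡i z))

F-at-suc : ∀ c z → F c (z + 1ℤ) ≡ rule172 (c z) (c (z + 1ℤ)) (c (z + 1ℤ + 1ℤ))
F-at-suc c z = F-at-values c (z + 1ℤ) (cong c (i+1-1≡i z)) refl refl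

F-local : ∀ {c d z} → c (z - 1ℤ) ≡ d (z - 1ℤ) → c z ≡ d z → c (z + 1ℤ) ≡ d (z + 1ℤ) →
  F c z ≡ F d z
F-local {c} {d} {z} e₋ e₀ e₊ = trans (F-at-values c z e₋ e₀ e₊) (sym (F-at d z))

F-cong : ∀ {c d} → (∀ z → c z ≡ d z) → ∀ z → F c z ≡ F d z
F-cong {c} {d} c≗d z = F-local {c} {d} (c≗d _) (c≗d _) (c≗d _)

F-translate : ∀ c s z → F (λ y → c (y + s)) z ≡ F c (z + s)
F-translate c s z =
  trans (F-at-values (λ y → c (y + s)) z (cong c (shift₋ z s)) refl (cong c (shift₊ z s))) (sym (F-at c (z + s)))
  where
  shift₋ : ∀ z s → z - 1ℤ + s ≡ z + s - 1ℤ
  shift₋ = solve-∀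
  shift₊ : ∀ z s → z + 1ℤ + s ≡ z + s + 1ℤ
  shift₊ = solve-∀

F-differs : ∀ {c d z} → ¬ F c z ≡ F d z →
  ¬ c (z - 1ℤ) ≡ d (z - 1ℤ) ⊎ ¬ c z ≡ d z ⊎ ¬ c (z + 1ℤ) ≡ d (z + 1ℤ)
F-differs {c} {d} {z} Fc≢Fd
  with c (z - 1ℤ) ≟ᵇ d (z - 1ℤ) | c z ≟ᵇ d z | c (z + 1ℤ) ≟ᵇ d (z + 1ℤ)
... | no ne | _     | _     = inj₁ ne
... | yes _ | no ne | _     = inj₂ (inj₁ ne)
... | yes _ | yes _ | no ne = inj₂ (inj₂ ne)
... | yes e₋ | yes e₀ | yes e₊ = ⊥-elim (Fc≢Fd (F-local {c} {d} e₋ e₀ e₊))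

record Wall (c : Config) (z : ℤ) : Set where
  constructor wall
  field
    left  : c (z - 1ℤ) ≡ false
    right : c z ≡ false

WallFree : Config → Set
WallFree c = ∀ z → ¬ Wall c z

record Gap (c : Config) (z : ℤ) : Set where
  constructor gap
  field
    left  : c (z - 1ℤ) ≡ false
    right : c (z + 1ℤ) ≡ false

GapFree : Config → Set
GapFree c = ∀ z → ¬ Gap c z

wall? : ∀ c z → Dec (Wall c z)
wall? c z = map′ (λ (e₋ , e₀) → wall e₋ e₀) (λ (wall e₋ e₀) → e₋ , e₀)
  ((c (z - 1ℤ) ≟ᵇ false) ×-dec (c z ≟ᵇ false))

wall-F : ∀ {c z} → Wall c z → Wall (F c) z
wall-F {c} {z} (wall c₋ c₀) = wall
  (trans (F-at-values c (z - 1ℤ) refl c₋ (trans (cong c (i-1+1≡i z)) c₀)) (rule172-ff _))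
  (F-at-values c z c₋ c₀ refl)

wall-iter : ∀ {c z} → Wall c z → ∀ t → Wall (iter F t c) z
wall-iter w zero    = w
wall-iter w (suc t) = wall-F (wall-iter w t)

F-wall-origin : ∀ {c z} → Wall (F c) z → Wall c (z - 1ℤ) ⊎ Wall c z ⊎ Wall c (z + 1ℤ)
F-wall-origin {c} {z} (wall f₋ f₀)
  with rule172-wall-origin _ _ _ _ (trans (sym (F-at-pred c z)) f₋) (trans (sym (F-at c z)) f₀)
... | inj₁ (c₋₂ , c₋)        = inj₁ (wall c₋₂ c₋)
... | inj₂ (inj₁ (c₋ , c₀)) = inj₂ (inj₁ (wall c₋ c₀))
... | inj₂ (inj₂ (c₀ , c₊)) = inj₂ (inj₂ (wall (trans (cong c (i+1-1≡i z)) c₀) c₊))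

wallFree-F : ∀ {c} → WallFree c → WallFree (F c)
wallFree-F nw z w = [ nw _ , [ nw _ , nw _ ]′ ]′ (F-wall-origin w)

wallFree-iter : ∀ {c} → WallFree c → ∀ t → WallFree (iter F t c)
wallFree-iter nw zero    = nw
wallFree-iter nw (suc t) = wallFree-F (wallFree-iter nw t)

F-gap-origin : ∀ {c z} → Gap (F c) z → Wall c (z - 1ℤ) ⊎ Wall c (z + 1ℤ)
F-gap-origin {c} {z} (gap f₋ f₊)
  with rule172-gap-origin _ _ _ _ _ (trans (sym (F-at-pred c z)) f₋) (trans (sym (F-at-suc c z)) f₊)
... | inj₁ (c₋₂ , c₋) = inj₁ (wall c₋₂ c₋)
... | inj₂ (c₀ , c₊)  = inj₂ (wall (trans (cong c (i+1-1≡i z)) c₀) c₊)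

gapFree-F : ∀ {c} → WallFree c → GapFree (F c)
gapFree-F nw z g = [ nw _ , nw _ ]′ (F-gap-origin g)

F-shift : ∀ {c} → WallFree c → GapFree c → ∀ z → F c z ≡ c (z + 1ℤ)
F-shift {c} nw ng z = trans (F-at c z)
  (rule172-copies-right _ _ _ (λ (e₋ , e₀) → nw z (wall e₋ e₀)) (λ (e₋ , e₊) → ng z (gap e₋ e₊)))

iter-F-shift : ∀ {c} → WallFree c → ∀ t z → iter F (suc t) c z ≡ F c (z + + t)
iter-F-shift {c} nw zero    z = cong (F c) (sym (ℤₚ.+-identityʳ z))
iter-F-shift {c} nw (suc t) z = begin
  F (iter F (suc t) c) z              ≡⟨ F-cong (λ y → iter-F-shift nw t y) z ⟩
  F (λ y → F c (y + + t)) z           ≡⟨ F-translate (F c) (+ t) z ⟩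
  F (F c) (z + + t)                   ≡⟨ F-shift (wallFree-F nw) (gapFree-F nw) (z + + t) ⟩
  F c (z + + t + 1ℤ)                  ≡⟨ cong (F c) (+-suc-offset z (+ t)) ⟩
  F c (z + + suc t)                   ∎
  where
  open ≡-Reasoning
  +-suc-offset : ∀ z t → z + t + 1ℤ ≡ z + (1ℤ + t)
  +-suc-offset = solve-∀

DiffWithin : Config → Config → ℤ → ℕ → Set
DiffWithin c d a w = ∀ z → ¬ c z ≡ d z → ∃[ k ] k ℕ.< w × z ≡ a + + k

-- SInv F u x unfolds to  ∃[ w ] ∀ t → ∃[ a ] Confined (iter F t (per u)) (iter F t (patch u x)) a w.
Confined : Config → Config → ℤ → ℕ → Set
Confined c d a w = ∀ z → ¬ c z ≡ d z → a ℤ.≤ z × z ℤ.< a + + w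

diffWithin⇒confined : ∀ {c d a w} → DiffWithin c d a w → Confined c d a w
diffWithin⇒confined {a = a} within z c≢d with within z c≢d
... | k , k<w , refl = ℤₚ.i≤i+j a (+ k) , ℤₚ.+-monoʳ-< a (ℤ.+<+ k<w)

diffWithin-widen : ∀ {c d a w w′} → w ℕ.≤ w′ → DiffWithin c d a w → DiffWithin c d a w′
diffWithin-widen w≤w′ within z c≢d with within z c≢d
... | k , k<w , z≡a+k = k , ℕₚ.<-≤-trans k<w w≤w′ , z≡a+k

diffWithin-F : ∀ {c d a w} → DiffWithin c d a w → DiffWithin (F c) (F d) (a - 1ℤ) (2 ℕ.+ w)
diffWithin-F {c} {d} {a} {w} within z Fc≢Fd with F-differs {c} {d} Fc≢Fd
... | inj₁ c≢d with within (z - 1ℤ) c≢d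
...   | k , k<w , eq =
  2 ℕ.+ k , s≤s (s≤s k<w) , trans (sym (i-1+1≡i z)) (trans (cong (_+ 1ℤ) eq) (from-pred a (+ k)))
  where
  from-pred : ∀ a k → a + k + 1ℤ ≡ a - 1ℤ + (+ 2 + k)
  from-pred = solve-∀
diffWithin-F {c} {d} {a} {w} within z Fc≢Fd | inj₂ (inj₁ c≢d) with within z c≢d
...   | k , k<w , eq = suc k , s≤s (ℕₚ.m≤n⇒m≤1+n k<w) , trans eq (from-here a (+ k))
  where
  from-here : ∀ a k → a + k ≡ a - 1ℤ + (1ℤ + k)
  from-here = solve-∀
diffWithin-F {c} {d} {a} {w} within z Fc≢Fd | inj₂ (inj₂ c≢d) with within (z + 1ℤ) c≢d
...   | k , k<w , eq =
  k , ℕₚ.≤-trans k<w (ℕₚ.m≤n+m w 2) ,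
  trans (sym (i+1-1≡i z)) (trans (cong (_- 1ℤ) eq) (from-suc a (+ k)))
  where
  from-suc : ∀ a k → a + k - 1ℤ ≡ a - 1ℤ + k
  from-suc = solve-∀

diffWithin-translate : ∀ {c d c′ d′ a w} s →
  (∀ z → c′ z ≡ c (z + s)) → (∀ z → d′ z ≡ d (z + s)) → DiffWithin c d a w → DiffWithin c′ d′ (a - s) w
diffWithin-translate {a = a} s c′≗c d′≗d within z c′≢d′
  with within (z + s) (λ c≡d → c′≢d′ (trans (c′≗c z) (trans c≡d (sym (d′≗d z)))))
... | k , k<w , eq = k , k<w , trans (sym (+s-s z s)) (trans (cong (_- s) eq) (rearrange a s (+ k)))
  where
  +s-s : ∀ z s → z + s - s ≡ z
  +s-s = solve-∀
  rearrange : ∀ a s k → a + k - s ≡ a - s + k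
  rearrange = solve-∀

confined-far-apart : ∀ {c d a w} b {e₁ e₂} → Confined c d a w →
  ¬ c (b - + e₁) ≡ d (b - + e₁) → ¬ c (b - + e₂) ≡ d (b - + e₂) → e₂ ℕ.+ w ℕ.≤ e₁ → ⊥
confined-far-apart {a = a} {w} b {e₁} {e₂} confined c≢d₁ c≢d₂ e₂+w≤e₁
  with ℕₚ.m≤n⇒∃[o]m+o≡n e₂+w≤e₁
... | δ , refl = ℤₚ.<-irrefl refl (ℤₚ.<-≤-trans (proj₂ (confined _ c≢d₂)) (begin
  a + + w                          ≤⟨ ℤₚ.+-monoˡ-≤ (+ w) (proj₁ (confined _ c≢d₁)) ⟩
  b - + (e₂ ℕ.+ w ℕ.+ δ) + + w     ≡⟨ rearrange b (+ e₂) (+ w) (+ δ) ⟩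
  b - + e₂ - + δ                   ≤⟨ ℤₚ.i-j≤i _ (+ δ) ⟩
  b - + e₂                         ∎))
  where
  open ℤₚ.≤-Reasoning
  rearrange : ∀ b e w δ → b - (e + w + δ) + w ≡ b - e - δ
  rearrange = solve-∀

-- Periodic configurations and patches

-[1+]%ℕ : ∀ a d .{{_ : ℕ.NonZero d}} → -[1+ a ] %ℕ d ≡ (d ∸ suc a ℕ.% d) ℕ.% d
-[1+]%ℕ a d@(suc d-1) with suc a ℕ.% d
... | zero  = sym (n%n≡0 d)
... | suc r = sym (m<n⇒m%n≡m (s≤s (ℕₚ.m∸n≤m d-1 r)))

%ℕ-periodic : ∀ z d .{{_ : ℕ.NonZero d}} → (z + + d) %ℕ d ≡ z %ℕ d
%ℕ-periodic (+ a)    d = [m+n]%n≡m%n a d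
%ℕ-periodic -[1+ a ] d with ℕₚ.<-cmp (suc a) d
... | tri< 1+a<d _ _ with ℕₚ.m≤n⇒∃[o]m+o≡n 1+a<d
...   | e , refl = begin
  (-[1+ a ] + + suc (suc a ℕ.+ e)) %ℕ d   ≡⟨ cong (_%ℕ d) (-[1+a]+[2+a+e] (+ a) (+ e)) ⟩
  suc e ℕ.% d                            ≡⟨ cong (ℕ._% d) (sym ([2+a+e]∸[1+a] a e)) ⟩
  (d ∸ suc a) ℕ.% d                      ≡⟨ cong (λ r → (d ∸ r) ℕ.% d) (sym (m<n⇒m%n≡m 1+a<d)) ⟩
  (d ∸ suc a ℕ.% d) ℕ.% d                ≡⟨ sym (-[1+]%ℕ a d) ⟩
  -[1+ a ] %ℕ d                          ∎
  where
  open ≡-Reasoning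
  -[1+a]+[2+a+e] : ∀ a e → - (1ℤ + a) + (1ℤ + (1ℤ + (a + e))) ≡ 1ℤ + e
  -[1+a]+[2+a+e] = solve-∀
  [2+a+e]∸[1+a] : ∀ a e → suc (suc (a ℕ.+ e)) ∸ suc a ≡ suc e
  [2+a+e]∸[1+a] zero    e = refl
  [2+a+e]∸[1+a] (suc a) e = [2+a+e]∸[1+a] a e
%ℕ-periodic -[1+ a ] d | tri≈ _ refl _ = begin
  (-[1+ a ] + + suc a) %ℕ d          ≡⟨ cong (_%ℕ d) (ℤₚ.+-inverseˡ (+ suc a)) ⟩
  0                                   ≡⟨ sym (n%n≡0 d) ⟩
  d ℕ.% d                             ≡⟨ cong (λ r → (d ∸ r) ℕ.% d) (sym (n%n≡0 d)) ⟩
  (d ∸ d ℕ.% d) ℕ.% d                 ≡⟨ sym (-[1+]%ℕ a d) ⟩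
  -[1+ a ] %ℕ d                       ∎
  where open ≡-Reasoning
%ℕ-periodic -[1+ a ] d | tri> _ _ d<1+a with ℕₚ.m≤n⇒∃[o]m+o≡n (ℕₚ.m<1+n⇒m≤n d<1+a)
...   | e , refl = begin
  (-[1+ d ℕ.+ e ] + + d) %ℕ d              ≡⟨ cong (_%ℕ d) (-[1+d+e]+d (+ d) (+ e)) ⟩
  -[1+ e ] %ℕ d                            ≡⟨ -[1+]%ℕ e d ⟩
  (d ∸ suc e ℕ.% d) ℕ.% d                  ≡⟨ cong (λ r → (d ∸ r) ℕ.% d) (sym 1+d+e≡1+e) ⟩
  (d ∸ suc (d ℕ.+ e) ℕ.% d) ℕ.% d          ≡⟨ sym (-[1+]%ℕ (d ℕ.+ e) d) ⟩
  -[1+ d ℕ.+ e ] %ℕ d                      ∎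
  where
  open ≡-Reasoning
  -[1+d+e]+d : ∀ d e → - (1ℤ + (d + e)) + d ≡ - (1ℤ + e)
  -[1+d+e]+d = solve-∀
  1+d+e≡1+e : suc (d ℕ.+ e) ℕ.% d ≡ suc e ℕ.% d
  1+d+e≡1+e = trans (cong (ℕ._% d) (cong suc (ℕₚ.+-comm d e))) ([m+n]%n≡m%n (suc e) d)

periodic-* : ∀ {A : Set} (f : ℤ → A) c → (∀ z → f (z + c) ≡ f z) → ∀ q z → f (z + q * c) ≡ f z
periodic-* f c periodic (+ k)    z = periodic-+* k z
  where
  periodic-+* : ∀ k z → f (z + + k * c) ≡ f z
  periodic-+* zero    z = cong f (zero-multiple z c)
    where
    zero-multiple : ∀ z c → z + 0ℤ * c ≡ z
    zero-multiple = solve-∀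
  periodic-+* (suc k) z = begin
    f (z + + suc k * c)        ≡⟨ cong f (peel z (+ k) c) ⟩
    f (z + + k * c + c)        ≡⟨ periodic _ ⟩
    f (z + + k * c)            ≡⟨ periodic-+* k z ⟩
    f z                        ∎
    where
    open ≡-Reasoning
    peel : ∀ z k c → z + (1ℤ + k) * c ≡ z + k * c + c
    peel = solve-∀
periodic-* f c periodic -[1+ k ] z = begin
  f (z + -[1+ k ] * c)                     ≡⟨ sym (periodic-* f c periodic (+ suc k) _) ⟩
  f (z + -[1+ k ] * c + + suc k * c)       ≡⟨ cong f (cancel z (+ suc k) c) ⟩
  f z                                      ∎
  where
  open ≡-Reasoning
  cancel : ∀ z k c → z + - k * c + k * c ≡ z
  cancel = solve-∀

wall-periodic : ∀ {c} p → (∀ z → c (z + p) ≡ c z) → ∀ q {z} → Wall c z → Wall c (z + q * p)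
wall-periodic {c} p periodic q {z} (wall c₋ c₀) = wall
  (trans (cong c (pred-shift z q p)) (trans (periodic-* c p periodic q (z - 1ℤ)) c₋))
  (trans (periodic-* c p periodic q z) c₀)
  where
  pred-shift : ∀ z q p → z + q * p - 1ℤ ≡ z - 1ℤ + q * p
  pred-shift = solve-∀

module _ {m} (u : Vec Bool (suc m)) where

  per-periodic : ∀ z → per u (z + + suc m) ≡ per u z
  per-periodic z = cong (lookup u) (Finₚ.fromℕ<-cong _ _ (%ℕ-periodic z (suc m)) _ _)

  per-wallFree : (∀ k → k ℕ.< suc m → ¬ Wall (per u) (+ k)) → WallFree (per u)
  per-wallFree noWallInPeriod z w = noWallInPeriod (z %ℕ suc m) (n%ℕd<d z (suc m))
    (subst (Wall (per u)) (residue z)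
      (wall-periodic (+ suc m) per-periodic (- (z /ℕ suc m)) w))
    where
    residue : ∀ z → z + - (z /ℕ suc m) * + suc m ≡ + (z %ℕ suc m)
    residue z = begin
      z + - q * + suc m
        ≡⟨ cong (λ y → y + - q * + suc m) (a≡a%ℕn+[a/ℕn]*n z (suc m)) ⟩
      + (z %ℕ suc m) + q * + suc m + - q * + suc m
        ≡⟨ cancel (+ (z %ℕ suc m)) q (+ suc m) ⟩
      + (z %ℕ suc m)
        ∎
      where
      open ≡-Reasoning
      q = z /ℕ suc m
      cancel : ∀ r q l → r + q * l + - q * l ≡ r
      cancel = solve-∀

module _ {m n} (u : Vec Bool (suc m)) (x : Vec Bool n) where

  patch-diffWithin : DiffWithin (per u) (patch u x) 0ℤ n
  patch-diffWithin -[1+ _ ] p≢q = ⊥-elim (p≢q refl)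
  patch-diffWithin (+ k)    p≢q with k ℕ.<? n
  ... | yes k<n = k , k<n , refl
  ... | no  _   = ⊥-elim (p≢q refl)

  patch-beyond : ∀ k → n ℕ.≤ k → patch u x (+ k) ≡ per u (+ k)
  patch-beyond k n≤k with k ℕ.<? n
  ... | yes k<n = ⊥-elim (ℕₚ.<⇒≱ k<n n≤k)
  ... | no  _   = refl

sinv-of-wallFree : ∀ {m n} (u : Vec Bool (suc m)) (x : Vec Bool n) →
  WallFree (per u) → WallFree (patch u x) → SInv F u x
sinv-of-wallFree {n = n} u x p-free q-free = 2 ℕ.+ n , λ where
  zero    → 0ℤ , diffWithin⇒confined (diffWithin-widen {a = 0ℤ} (ℕₚ.m≤n+m n 2) (patch-diffWithin u x))
  (suc t) → 0ℤ - 1ℤ - + t , diffWithin⇒confined (diffWithin-translate {a = 0ℤ - 1ℤ} (+ t)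
    (iter-F-shift p-free t) (iter-F-shift q-free t) (diffWithin-F {a = 0ℤ} (patch-diffWithin u x)))

-- Walls seal off differences

pred-leftOffset : ∀ b k → b - + k - 1ℤ ≡ b - + suc k
pred-leftOffset b k = lemma b (+ k)
  where
  lemma : ∀ b k → b - k - 1ℤ ≡ b - (1ℤ + k)
  lemma = solve-∀

suc-leftOffset : ∀ b k → b - + suc k + 1ℤ ≡ b - + k
suc-leftOffset b k = lemma b (+ k)
  where
  lemma : ∀ b k → b - (1ℤ + k) + 1ℤ ≡ b - k
  lemma = solve-∀

pred-rightOffset : ∀ b k → b + + suc k - 1ℤ ≡ b + + k
pred-rightOffset b k = lemma b (+ k)
  where
  lemma : ∀ b k → b + (1ℤ + k) - 1ℤ ≡ b + k
  lemma = solve-∀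

suc-rightOffset : ∀ b k → b + + k + 1ℤ ≡ b + + suc k
suc-rightOffset b k = lemma b (+ k)
  where
  lemma : ∀ b k → b + k + 1ℤ ≡ b + (1ℤ + k)
  lemma = solve-∀

agree-at : ∀ {c d : Config} {y y′} → y ≡ y′ → c y′ ≡ d y′ → c y ≡ d y
agree-at refl c≡d = c≡d

wall-transport : ∀ {c d z} → c (z - 1ℤ) ≡ d (z - 1ℤ) → c z ≡ d z → Wall c z → Wall d z
wall-transport e₋ e₀ (wall c₋ c₀) = wall (trans (sym e₋) c₋) (trans (sym e₀) c₀)

walls-agree : ∀ {c d z} → Wall c z → Wall d z → c z ≡ d z
walls-agree wc wd = trans (Wall.right wc) (sym (Wall.right wd))

AgreeLeftOf : Config → Config → ℤ → Set
AgreeLeftOf c d b = ∀ k → c (b - + k) ≡ d (b - + k)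

AgreeRightOf : Config → Config → ℤ → Set
AgreeRightOf c d b = ∀ k → c (b + + k) ≡ d (b + + k)

agreeLeftOf-F : ∀ {c d b} → Wall c b → Wall d b → AgreeLeftOf c d b → AgreeLeftOf (F c) (F d) b
agreeLeftOf-F {c} {d} {b} wc wd agree zero    =
  agree-at {F c} {F d} (ℤₚ.+-identityʳ b) (walls-agree (wall-F wc) (wall-F wd))
agreeLeftOf-F {c} {d} {b} wc wd agree (suc k) = F-local {c} {d}
  (agree-at {c} {d} (pred-leftOffset b (suc k)) (agree (suc (suc k))))
  (agree (suc k))
  (agree-at {c} {d} (suc-leftOffset b k) (agree k))

agreeRightOf-F : ∀ {c d b} → Wall c b → Wall d b → AgreeRightOf c d b → AgreeRightOf (F c) (F d) b
agreeRightOf-F {c} {d} {b} wc wd agree zero    =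
  agree-at {F c} {F d} (ℤₚ.+-identityʳ b) (walls-agree (wall-F wc) (wall-F wd))
agreeRightOf-F {c} {d} {b} wc wd agree (suc k) = F-local {c} {d}
  (agree-at {c} {d} (pred-rightOffset b k) (agree k))
  (agree (suc k))
  (agree-at {c} {d} (suc-rightOffset b (suc k)) (agree (suc (suc k))))

agreeLeftOf-iter : ∀ {c d b} → Wall c b → Wall d b → AgreeLeftOf c d b →
  ∀ t → AgreeLeftOf (iter F t c) (iter F t d) b
agreeLeftOf-iter wc wd agree zero    = agree
agreeLeftOf-iter wc wd agree (suc t) =
  agreeLeftOf-F (wall-iter wc t) (wall-iter wd t) (agreeLeftOf-iter wc wd agree t)

agreeRightOf-iter : ∀ {c d b} → Wall c b → Wall d b → AgreeRightOf c d b →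
  ∀ t → AgreeRightOf (iter F t c) (iter F t d) b
agreeRightOf-iter wc wd agree zero    = agree
agreeRightOf-iter wc wd agree (suc t) =
  agreeRightOf-F (wall-iter wc t) (wall-iter wd t) (agreeRightOf-iter wc wd agree t)

sealed-diffWithin : ∀ {c d l r w} → AgreeLeftOf c d l → AgreeRightOf c d r → r ≡ l + 1ℤ + + w →
  DiffWithin c d (l + 1ℤ) w
sealed-diffWithin {c} {d} {l} {r} {w} left right r≡ z c≢d with z - l | split z l
  where
  split : ∀ z l → z ≡ l + (z - l)
  split = solve-∀
... | -[1+ k ] | z≡ = ⊥-elim (c≢d (agree-at {c} {d} z≡ (left (suc k))))
... | + zero   | z≡ = ⊥-elim (c≢d (agree-at {c} {d} z≡ (left zero)))
... | + suc k  | z≡ with ℕₚ.<-≤-connex k w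
...   | inj₁ k<w = k , k<w , trans z≡ (reassociate l (+ k))
  where
  reassociate : ∀ l k → l + (1ℤ + k) ≡ l + 1ℤ + k
  reassociate = solve-∀
...   | inj₂ w≤k with ℕₚ.m≤n⇒∃[o]m+o≡n w≤k
...     | e , refl = ⊥-elim (c≢d (agree-at {c} {d} z≡r+e (right e)))
  where
  beyond : ∀ l w e → l + (1ℤ + (w + e)) ≡ l + 1ℤ + w + e
  beyond = solve-∀
  z≡r+e : z ≡ r + + e
  z≡r+e = trans z≡ (trans (beyond l (+ w) (+ e)) (cong (_+ + e) (sym r≡)))

sinv-of-periodic-wall : ∀ {m n} (u : Vec Bool (suc m)) (x : Vec Bool n) k → k ℕ.≤ m →
  Wall (per u) (+ k) → SInv F u x
sinv-of-periodic-wall {n = n} u x k k≤m w with ℕₚ.m≤n⇒∃[o]m+o≡n k≤m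
... | e , refl = e ℕ.+ suc R , λ t → -[1+ e ] + 1ℤ , diffWithin⇒confined (sealed-diffWithin {l = -[1+ e ]}
  (agreeLeftOf-iter wallˡ (wall-transport refl refl wallˡ) agreeˡ t)
  (agreeRightOf-iter wallʳ
    (wall-transport (beyond R ℕₚ.≤-refl) (beyond (suc R) (ℕₚ.n≤1+n R)) wallʳ) agreeʳ t)
  (seal-distance (+ e) (+ suc R)))
  where
  L = suc (k ℕ.+ e)
  R = k ℕ.+ (k ℕ.+ e ℕ.+ n ℕ.* L)

  beyond : ∀ j → R ℕ.≤ j → per u (+ j) ≡ patch u x (+ j)
  beyond j R≤j = sym (patch-beyond u x j (ℕₚ.≤-trans n≤R R≤j))
    where
    n≤R : n ℕ.≤ R
    n≤R = ℕₚ.≤-trans (ℕₚ.m≤m*n n L)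
      (ℕₚ.≤-trans (ℕₚ.m≤n+m (n ℕ.* L) (k ℕ.+ e)) (ℕₚ.m≤n+m _ k))

  agreeˡ : AgreeLeftOf (per u) (patch u x) -[1+ e ]
  agreeˡ zero    = refl
  agreeˡ (suc _) = refl

  agreeʳ : AgreeRightOf (per u) (patch u x) (+ suc R)
  agreeʳ j = beyond (suc R ℕ.+ j) (ℕₚ.≤-trans (ℕₚ.n≤1+n R) (ℕₚ.m≤m+n (suc R) j))

  wallˡ : Wall (per u) -[1+ e ]
  wallˡ = subst (Wall (per u)) (one-period-left (+ k) (+ e)) (wall-periodic (+ L) (per-periodic u) -1ℤ w)
    where
    one-period-left : ∀ k e → k + -1ℤ * (1ℤ + (k + e)) ≡ - (1ℤ + e)
    one-period-left = solve-∀

  wallʳ : Wall (per u) (+ suc R)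
  wallʳ = subst (Wall (per u)) (trans (cong (_+_ (+ k)) (sym (ℤₚ.pos-* (suc n) L))) (cong +_ (ℕₚ.+-suc k _)))
    (wall-periodic (+ L) (per-periodic u) (+ suc n) w)

  seal-distance : ∀ e r → r ≡ - (1ℤ + e) + 1ℤ + (e + r)
  seal-distance = solve-∀

-- Growth of a run of 0s

wall-leftOffset : ∀ c b k → c (b - + suc k) ≡ false → c (b - + k) ≡ false → Wall c (b - + k)
wall-leftOffset c b k c₋ c₀ = wall (trans (cong c (pred-leftOffset b k)) c₋) c₀

F-atˡ-values : ∀ c b k {x y z} → c (b - + suc (suc k)) ≡ x → c (b - + suc k) ≡ y → c (b - + k) ≡ z →
  F c (b - + suc k) ≡ rule172 x y z
F-atˡ-values c b k c₋ c₀ c₊ =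
  F-at-values c (b - + suc k) (trans (cong c (pred-leftOffset b (suc k))) c₋) c₀
    (trans (cong c (suc-leftOffset b k)) c₊)

record ZeroRun (b : ℤ) (c : Config) (s : ℕ) : Set where
  field
    1≤s          : 1 ℕ.≤ s
    zeros        : ∀ k → k ℕ.≤ s → c (b - + k) ≡ false
    edge         : c (b - + suc s) ≡ true
    noWallBeyond : ∀ k → s ℕ.< k → ¬ Wall c (b - + k)

module _ {b : ℤ} {c : Config} {s : ℕ} (run : ZeroRun b c s) where
  open ZeroRun run

  zeros-F : ∀ k → k ℕ.≤ s → F c (b - + k) ≡ false
  zeros-F zero    _   = F-at-values c (b - + 0) (trans (cong c (pred-leftOffset b 0)) (zeros 1 1≤s))
                          (zeros 0 z≤n) refl
  zeros-F (suc k) k<s =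
    trans (F-atˡ-values c b k refl (zeros (suc k) k<s) (zeros k (ℕₚ.<⇒≤ k<s))) (rule172-ff _)

  noWallBeyond-F : ∀ {s′} → s ℕ.≤ s′ → c (b - + suc s′) ≡ true →
    ∀ k → s′ ℕ.< k → ¬ Wall (F c) (b - + k)
  noWallBeyond-F {s′} s≤s′ one (suc k) s′<1+k Fw with F-wall-origin Fw
  ... | inj₁ w        = noWallBeyond (suc (suc k)) (ℕₚ.≤-<-trans s≤s′ (ℕₚ.m<n⇒m<1+n s′<1+k))
                          (subst (Wall c) (pred-leftOffset b (suc k)) w)
  ... | inj₂ (inj₁ w) = noWallBeyond (suc k) (ℕₚ.≤-<-trans s≤s′ s′<1+k) w
  ... | inj₂ (inj₂ w) with ℕₚ.m≤n⇒m<n∨m≡n (ℕₚ.m<1+n⇒m≤n s′<1+k)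
  ...   | inj₁ s′<k = noWallBeyond k (ℕₚ.≤-<-trans s≤s′ s′<k) (subst (Wall c) (suc-leftOffset b k) w)
  ...   | inj₂ refl = true≢false (trans (sym one) (trans (cong c (sym (i+1-1≡i _))) (Wall.left w)))
    where
    true≢false : true ≢ false
    true≢false ()

  grow-step : c (b - + suc (suc s)) ≡ true → ZeroRun b (F c) (suc s)
  grow-step one = record
    { 1≤s          = s≤s z≤n
    ; zeros        = zeros′
    ; edge         = trans (F-atˡ-values c b (suc s) refl one edge) (rule172-tt _)
    ; noWallBeyond = noWallBeyond-F (ℕₚ.n≤1+n s) one
    }
    where
    zeros′ : ∀ k → k ℕ.≤ suc s → F c (b - + k) ≡ false
    zeros′ k k≤1+s with ℕₚ.m≤n⇒m<n∨m≡n k≤1+s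
    ... | inj₁ k<1+s = zeros-F k (ℕₚ.m<1+n⇒m≤n k<1+s)
    ... | inj₂ refl  = F-atˡ-values c b s one refl (zeros s ℕₚ.≤-refl)

  stall-step : c (b - + suc (suc s)) ≡ false → ZeroRun b (F c) s × F c (b - + suc (suc s)) ≡ true
  stall-step zero₂ = record
    { 1≤s          = 1≤s
    ; zeros        = zeros-F
    ; edge         = F-atˡ-values c b s zero₂ edge refl
    ; noWallBeyond = noWallBeyond-F ℕₚ.≤-refl edge
    } , next-edge
    where
    next-edge : F c (b - + suc (suc s)) ≡ true
    next-edge with c (b - + suc (suc (suc s))) in zero₃
    ... | true  = F-atˡ-values c b (suc s) zero₃ zero₂ edge
    ... | false = ⊥-elim (noWallBeyond (suc (suc s)) (ℕₚ.m<n⇒m<1+n ℕₚ.≤-refl)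
                    (wall-leftOffset c b (suc (suc s)) zero₃ zero₂))

  grow-once : ∃[ s′ ] s ℕ.≤ s′ × ZeroRun b (F c) s′
  grow-once with c (b - + suc (suc s)) in e
  ... | true  = suc s , ℕₚ.n≤1+n s , grow-step e
  ... | false = s , ℕₚ.≤-refl , proj₁ (stall-step e)

grow-twice : ∀ {b c s} → ZeroRun b c s → ∃[ s′ ] s ℕ.< s′ × ZeroRun b (F (F c)) s′
grow-twice {b} {c} {s} run with c (b - + suc (suc s)) in e
... | true with grow-once (grow-step run e)
...   | s′ , 1+s≤s′ , run′ = s′ , 1+s≤s′ , run′
grow-twice run | false with stall-step run e
... | run′ , one = _ , ℕₚ.≤-refl , grow-step run′ one

grow : ∀ {b c s} → ZeroRun b c s → ∀ k → ∃[ t ] ∃[ s′ ] k ℕ.≤ s′ × ZeroRun b (iter F t c) s′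
grow {s = s} run zero = 0 , s , z≤n , run
grow run (suc k) with grow run k
... | t , s′ , k≤s′ , run′ with grow-twice run′
...   | s″ , s′<s″ , run″ = suc (suc t) , s″ , ℕₚ.≤-<-trans k≤s′ s′<s″ , run″

wallFree-differs-on-wall : ∀ {c d z} → WallFree c → Wall d z →
  ¬ c (z - 1ℤ) ≡ d (z - 1ℤ) ⊎ ¬ c z ≡ d z
wallFree-differs-on-wall {c} {d} {z} c-free wd with c (z - 1ℤ) ≟ᵇ d (z - 1ℤ) | c z ≟ᵇ d z
... | no c≢d | _      = inj₁ c≢d
... | yes _  | no c≢d = inj₂ c≢d
... | yes e₋ | yes e₀ = ⊥-elim (c-free z (wall-transport (sym e₋) (sym e₀) wd))

wallFree-differs-on-zeros : ∀ {c d} b k → WallFree c → d (b - + suc k) ≡ false → d (b - + k) ≡ false →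
  ∃[ e ] k ℕ.≤ e × e ℕ.≤ suc k × ¬ c (b - + e) ≡ d (b - + e)
wallFree-differs-on-zeros {c} {d} b k c-free d₋ d₀
  with wallFree-differs-on-wall c-free (wall-leftOffset d b k d₋ d₀)
... | inj₁ c≢d = suc k , ℕₚ.n≤1+n k , ℕₚ.≤-refl , c≢d ∘ agree-at {c} {d} (pred-leftOffset b k)
... | inj₂ c≢d = k , ℕₚ.≤-refl , ℕₚ.n≤1+n k , c≢d

zeroRun-of-leftmost-wall : ∀ {d b} → Wall d b → (∀ k → ¬ Wall d (b - + suc k)) → ZeroRun b d 1
zeroRun-of-leftmost-wall {d} {b} wd noWallLeft = record
  { 1≤s          = ℕₚ.≤-refl
  ; zeros        = λ { zero _ → trans (cong d (ℤₚ.+-identityʳ b)) (Wall.right wd)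
                     ; (suc zero) _ → Wall.left wd
                     ; (suc (suc _)) (s≤s ()) }
  ; edge         = edge
  ; noWallBeyond = λ { (suc (suc k)) _ → noWallLeft (suc k) ; (suc zero) (s≤s ()) }
  }
  where
  edge : d (b - + 2) ≡ true
  edge with d (b - + 2) in e
  ... | true  = refl
  ... | false = ⊥-elim (noWallLeft 0 (wall-leftOffset d b 1 e (Wall.left wd)))

leftmostWall-unconfined : ∀ {c d b} → WallFree c → Wall d b → (∀ k → ¬ Wall d (b - + suc k)) →
  ¬ (∃[ w ] ∀ t → ∃[ a ] Confined (iter F t c) (iter F t d) a w)
leftmostWall-unconfined {c} {d} {b} c-free wd noWallLeft (w , confined)
  with grow (zeroRun-of-leftmost-wall wd noWallLeft) (suc (suc w))
... | t , suc s , s≤s 1+w≤s , run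
  with confined t
     | wallFree-differs-on-zeros {d = iter F t d} b 0 (wallFree-iter c-free t)
         (zeros 1 (s≤s z≤n)) (zeros 0 z≤n)
     | wallFree-differs-on-zeros {d = iter F t d} b s (wallFree-iter c-free t)
         (zeros (suc s) ℕₚ.≤-refl) (zeros s (ℕₚ.n≤1+n s))
  where open ZeroRun run
...   | a , conf | e₂ , _ , e₂≤1 , c≢d₂ | e₁ , s≤e₁ , _ , c≢d₁ =
  confined-far-apart {iter F t c} {iter F t d} b conf c≢d₁ c≢d₂
    (ℕₚ.≤-trans (ℕₚ.+-monoˡ-≤ w e₂≤1) (ℕₚ.≤-trans 1+w≤s s≤e₁))

-- The leftmost wall of a patch

least-witness : ∀ {P : ℕ → Set} → (∀ k → Dec (P k)) → ∀ k → P k →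
  ∃[ k₀ ] P k₀ × (∀ j → j ℕ.< k₀ → ¬ P j)
least-witness {P} P? = <-rec (λ k → P k → Least) search
  where
  Least : Set
  Least = ∃[ k₀ ] P k₀ × (∀ j → j ℕ.< k₀ → ¬ P j)
  search : ∀ k → (∀ {j} → j ℕ.< k → P j → Least) → P k → Least
  search k smaller pk with ℕₚ.anyUpTo? P? k
  ... | yes (j , j<k , pj) = smaller j<k pj
  ... | no none            = k , pk , λ j j<k pj → none (j , j<k , pj)

WallIn : Config → ℕ → ℕ → Set
WallIn c lo len = ∃[ k ] k ℕ.< len × Wall c (+ (lo ℕ.+ k))

wallIn? : ∀ c lo len → Dec (WallIn c lo len)
wallIn? c lo = ℕₚ.anyUpTo? (λ k → wall? c (+ (lo ℕ.+ k)))

module _ {m n} (u : Vec Bool (suc m)) (x : Vec Bool n) (p-free : WallFree (per u)) where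

  patch-wall-position : ∀ {z} → Wall (patch u x) z → ∃[ k ] k ℕ.< suc n × z ≡ + k
  patch-wall-position { -[1+ _ ]} w = ⊥-elim (p-free _ (wall-transport refl refl w))
  patch-wall-position {+ zero}   w = 0 , s≤s z≤n , refl
  patch-wall-position {+ suc k}  w with suc k ℕ.≤? n
  ... | yes k<n = suc k , s≤s k<n , refl
  ... | no  k≮n = ⊥-elim (p-free _
          (wall-transport (patch-beyond u x k n≤k) (patch-beyond u x (suc k) (ℕₚ.m≤n⇒m≤1+n n≤k)) w))
    where
    n≤k : n ℕ.≤ k
    n≤k = ℕₚ.m<1+n⇒m≤n (ℕₚ.≰⇒> k≮n)

  leftmost-wall : ∀ {z} → Wall (patch u x) z →
    ∃[ b ] Wall (patch u x) b × (∀ k → ¬ Wall (patch u x) (b - + suc k))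
  leftmost-wall w with patch-wall-position w
  ... | k , _ , refl with least-witness (λ j → wall? (patch u x) (+ j)) k w
  ...   | k₀ , w₀ , minimal = + k₀ , w₀ , noWallLeft
    where
    inside : ∀ j e → (1ℤ + (j + e)) - (1ℤ + j) ≡ e
    inside = solve-∀
    outside : ∀ k e → k - (1ℤ + (k + e)) ≡ - (1ℤ + e)
    outside = solve-∀
    noWallLeft : ∀ j → ¬ Wall (patch u x) (+ k₀ - + suc j)
    noWallLeft j with ℕₚ.<-≤-connex j k₀
    ... | inj₁ j<k₀ with ℕₚ.m≤n⇒∃[o]m+o≡n j<k₀
    ...   | e , refl = λ w′ →
      minimal e (ℕₚ.m<n+m e (s≤s z≤n)) (subst (Wall (patch u x)) (inside (+ j) (+ e)) w′)
    noWallLeft j | inj₂ k₀≤j with ℕₚ.m≤n⇒∃[o]m+o≡n k₀≤j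
    ... | e , refl = λ w′ →
      p-free -[1+ e ] (wall-transport refl refl (subst (Wall (patch u x)) (outside (+ k₀) (+ e)) w′))

  sinv⇔noWall : SInv F u x ⇔ (¬ WallIn (patch u x) 0 (suc n))
  sinv⇔noWall = mk⇔
    (λ sinv (k , _ , w) → let b , wb , noWallLeft = leftmost-wall w in
      leftmostWall-unconfined p-free wb noWallLeft sinv)
    (λ noWall → sinv-of-wallFree u x p-free λ z w → let k , k<1+n , z≡k = patch-wall-position w in
      noWall (k , k<1+n , subst (Wall (patch u x)) z≡k w))

-- The protocol

Computes-resp-⇔ : ∀ {X Y : Set} {P : Protocol X Y} {G H : X → Y → Set} →
  (∀ x y → G x y ⇔ H x y) → Computes P G → Computes P H
Computes-resp-⇔ G⇔H computes x y =
  Equivalence.to (G⇔H x y) ∘ proj₁ (computes x y) , proj₂ (computes x y) ∘ Equivalence.from (G⇔H x y)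

rejects⇔¬ : ∀ {S : Set} (d : Dec S) → (if does d then false else true) ≡ true ⇔ (¬ S)
rejects⇔¬ (yes s) = mk⇔ (λ ()) (λ ¬s → ⊥-elim (¬s s))
rejects⇔¬ (no ¬s) = mk⇔ (λ _ → ¬s) (λ _ → refl)

module TwoRound {X Y : Set} {A : X → Set} {B : Bool → Y → Set}
  (A? : ∀ x → Dec (A x)) (β : X → Bool) (B? : ∀ b y → Dec (B b y)) where

  protocol : Protocol X Y
  protocol = alice (does ∘ A?) (alice β (answer false) (answer true)) (leaf false)
    where
    answer : Bool → Protocol X Y
    answer b = bob (does ∘ B? b) (leaf true) (leaf false)

  run-protocol : ∀ x y → run protocol x y ≡ (if does (A? x ⊎-dec B? (β x) y) then false else true)
  run-protocol x y with A? x | β x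
  ... | yes _ | _     = refl
  ... | no  _ | false = refl
  ... | no  _ | true  = refl

  computes : Computes protocol (λ x y → ¬ (A x ⊎ B (β x) y))
  computes x y rewrite run-protocol x y =
    Equivalence.to (rejects⇔¬ (A? x ⊎-dec B? (β x) y)) , Equivalence.from (rejects⇔¬ (A? x ⊎-dec B? (β x) y))

patch-agree : ∀ {m N} (u : Vec Bool (suc m)) {v v′ : Vec Bool N} k →
  (∀ (k<N : k ℕ.< N) → lookup v (fromℕ< k<N) ≡ lookup v′ (fromℕ< k<N)) →
  patch u v (+ k) ≡ patch u v′ (+ k)
patch-agree {N = N} u k same with k ℕ.<? N
... | yes k<N = same k<N
... | no  _   = refl

module Split {m} (u : Vec Bool (suc m)) (i j : ℕ) where

  aliceView : Vec Bool i → Config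
  aliceView xa = patch u (xa ++ replicate j false)

  bobView : Vec Bool j → Config
  bobView xb = patch u (replicate i false ++ xb)

  lastAliceCell : Vec Bool i → Bool
  lastAliceCell xa = aliceView xa (+ i - 1ℤ)

  AliceWall : Vec Bool i → Set
  AliceWall xa = WallIn (aliceView xa) 0 i

  -- b stands for Alice's cell i - 1.
  BobWall : Bool → Vec Bool j → Set
  BobWall b xb = (b ≡ false × bobView xb (+ i) ≡ false) ⊎ WallIn (bobView xb) (suc i) j

  bobWall? : ∀ b xb → Dec (BobWall b xb)
  bobWall? b xb = ((b ≟ᵇ false) ×-dec (bobView xb (+ i) ≟ᵇ false)) ⊎-dec wallIn? (bobView xb) (suc i) j

  module _ (xa : Vec Bool i) (xb : Vec Bool j) where

    alice-agrees : ∀ k → k ℕ.< i → patch u (xa ++ xb) (+ k) ≡ aliceView xa (+ k)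
    alice-agrees k k<i = patch-agree u k λ k<N →
      trans (VecP.lookup-++-< xa xb _ (lt k<N)) (sym (VecP.lookup-++-< xa (replicate j false) _ (lt k<N)))
      where
      lt : ∀ k<N → Fin.toℕ (fromℕ< {k} {i ℕ.+ j} k<N) ℕ.< i
      lt k<N = subst (ℕ._< i) (sym (Finₚ.toℕ-fromℕ< k<N)) k<i

    alice-agrees-pred : ∀ k → k ℕ.≤ i → patch u (xa ++ xb) (+ k - 1ℤ) ≡ aliceView xa (+ k - 1ℤ)
    alice-agrees-pred zero    _   = refl
    alice-agrees-pred (suc k) k<i = alice-agrees k k<i

    bob-agrees : ∀ k → i ℕ.≤ k → patch u (xa ++ xb) (+ k) ≡ bobView xb (+ k)
    bob-agrees k i≤k = patch-agree u k λ k<N →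
      trans (VecP.lookup-++-≥ xa xb _ (ge k<N)) (sym (VecP.lookup-++-≥ (replicate i false) xb _ (ge k<N)))
      where
      ge : ∀ k<N → i ℕ.≤ Fin.toℕ (fromℕ< {k} {i ℕ.+ j} k<N)
      ge k<N = subst (i ℕ.≤_) (sym (Finₚ.toℕ-fromℕ< k<N)) i≤k

    wallIn⇔split : WallIn (patch u (xa ++ xb)) 0 (suc (i ℕ.+ j)) ⇔ (AliceWall xa ⊎ BobWall (lastAliceCell xa) xb)
    wallIn⇔split = mk⇔ to from
      where
      to : WallIn (patch u (xa ++ xb)) 0 (suc (i ℕ.+ j)) → AliceWall xa ⊎ BobWall (lastAliceCell xa) xb
      to (k , k<1+n , w) with ℕₚ.<-cmp k i
      ... | tri< k<i _ _ = inj₁ (k , k<i ,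
            wall-transport (alice-agrees-pred k (ℕₚ.<⇒≤ k<i)) (alice-agrees k k<i) w)
      ... | tri≈ _ refl _ = inj₂ (inj₁
            (trans (sym (alice-agrees-pred k ℕₚ.≤-refl)) (Wall.left w) ,
             trans (sym (bob-agrees k ℕₚ.≤-refl)) (Wall.right w)))
      ... | tri> _ _ i<k with ℕₚ.m≤n⇒∃[o]m+o≡n i<k
      ...   | e , refl = inj₂ (inj₂ (e , ℕₚ.+-cancelˡ-< i e j (ℕₚ.m<1+n⇒m≤n k<1+n) ,
            wall-transport (bob-agrees (i ℕ.+ e) (ℕₚ.m≤m+n i e))
              (bob-agrees (suc i ℕ.+ e) (ℕₚ.m≤n⇒m≤1+n (ℕₚ.m≤m+n i e))) w))
      from : AliceWall xa ⊎ BobWall (lastAliceCell xa) xb → WallIn (patch u (xa ++ xb)) 0 (suc (i ℕ.+ j))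
      from (inj₁ (k , k<i , w)) = k , ℕₚ.m≤n⇒m≤1+n (ℕₚ.≤-trans k<i (ℕₚ.m≤m+n i j)) ,
        wall-transport (sym (alice-agrees-pred k (ℕₚ.<⇒≤ k<i))) (sym (alice-agrees k k<i)) w
      from (inj₂ (inj₁ (a₋ , b₀))) = i , s≤s (ℕₚ.m≤m+n i j) ,
        wall (trans (alice-agrees-pred i ℕₚ.≤-refl) a₋) (trans (bob-agrees i ℕₚ.≤-refl) b₀)
      from (inj₂ (inj₂ (e , e<j , w))) = suc i ℕ.+ e , s≤s (ℕₚ.+-monoʳ-< i e<j) ,
        wall-transport (sym (bob-agrees (i ℕ.+ e) (ℕₚ.m≤m+n i e)))
          (sym (bob-agrees (suc i ℕ.+ e) (ℕₚ.m≤n⇒m≤1+n (ℕₚ.m≤m+n i e)))) w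

  open TwoRound (λ xa → wallIn? (aliceView xa) 0 i) lastAliceCell bobWall? public

proposition10 : ∀ (m : ℕ) (u : Vec Bool (suc m)) →
    ∃[ C ] ∃[ N ] ∀ (n : ℕ) → n ≥ N → DSInv≤ (ECA 172) u n C
proposition10 m u with ℕₚ.anyUpTo? (λ k → wall? (per u) (+ k)) (suc m)
... | yes (k , k<1+m , w) = 3 , 0 , λ { n _ i j refl →
  leaf true , z≤n , λ xa xb →
    (λ _ → sinv-of-periodic-wall u (xa ++ xb) k (ℕₚ.m<1+n⇒m≤n k<1+m) w) , λ _ → refl }
... | no noPeriodicWall = 3 , 0 , λ { n _ i j refl → let open Split u i j in
  protocol , ℕₚ.≤-refl , Computes-resp-⇔ {P = protocol} (λ xa xb →
    ⇔-sym (⇔-trans (sinv⇔noWall u (xa ++ xb) p-free) (¬-cong-⇔ (wallIn⇔split xa xb)))) computes }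
  where
  p-free : WallFree (per u)
  p-free = per-wallFree u λ k k<1+m w → noPeriodicWall (k , k<1+m , w)
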